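{- Let $G$ be a finite group and let $S$ be a set of generators of $G$ with $e\in S=S^{ -1}$. Suppose that $G$ acts transitively on a finite set $V$, and let $\mathfrak{X}_S$ be the configuration coming from the Schreier graph $\mathrm{Sch}(V,S)$. Then the number $WL(\mathfrak{X}_S)$ of nontrivial iterations of the Weisfeiler-Leman algorithm applied to $\mathfrak{X}_S$ satisfies $$WL(\mathfrak{X}_S)\leq \log_2 \mathrm{diam}\,\mathrm{Sch}(V,S)+3 .$$
   Context: The Schreier graph $\mathrm{Sch}(V,S)$ has vertex set $V$ and (multi)edge set $\{(v,sv): v\in V, s\in S\}$; its diameter is the maximum over ordered pairs of vertices of the length of a shortest directed path between them (finite since $S$ generates $G$ and the action is transitive). The configuration $\mathfrak{X}_S$ is the pair $(V,c)$ with colouring $c:V^2\to\mathcal{P}(S)$, $c(v_1,v_2)=\{s\in S: sv_1=v_2\}$. Weisfeiler-Leman algorithm: for a set $\Gamma$ with colouring $c:\Gamma^2\to\mathcal{C}$, put $c^{(0)}=c$, $\mathcal{C}^{(0)}=\mathcal{C}$, and define $c^{(h+1)}(v_1,v_2)$ to be the tuple consisting of $c^{(h)}(v_1,v_2)$ together with the family of numbers $\left|\{w\in\Gamma: c^{(h)}(v_1,w)=c_1,\ c^{(h)}(w,v_2)=c_2\}\right|$ indexed by $(c_1,c_2)\in\mathcal{C}^{(h)}\times\mathcal{C}^{(h)}$; $\mathcal{C}^{(h+1)}$ is the set of values of $c^{(h+1)}$. Each $c^{(h+1)}$ refines $c^{(h)}$. The number of nontrivial iterations $WL$ is the least $h\geq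 0$ such that the partition of $\Gamma^2$ into colour classes of $c^{(h+1)}$ equals that of $c^{(h)}$ (i.e. the final iteration producing no refinement is not counted). -}

module Defs where

open import Level using (Level)
open import Data.Nat using (ℕ; zero; suc; _+_; _≤_; _<_; _≡ᵇ_)
open import Data.Bool using (Bool; true; false; _∧_; not; _xor_; if_then_else_; T)
open import Data.Fin using (Fin; _≟_)
import Data.Fin as F
open import Data.List using (List; []; _∷_; length; foldr)
open import Data.Product using (Σ; ∃; ∃-syntax; _×_; _,_)
open import Relation.Nullary using (¬_)
open import Relation.Nullary.Decidable using (⌊_⌋)
open import Relation.Binary.PropositionalEquality using (_≡_)
open import Algebra.Bundles using (Group)

allF : ∀ {n} → (Fin n → Bool) → Bool
allF {zero}  f = true
allF {suc n} f = f F.zero ∧ allF (λ i → f (F.suc i))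

countF : ∀ {n} → (Fin n → Bool) → ℕ
countF {zero}  f = 0
countF {suc n} f = (if f F.zero then 1 else 0) + countF (λ i → f (F.suc i))

eqB : Bool → Bool → Bool
eqB x y = not (x xor y)

eqF : ∀ {n} → Fin n → Fin n → Bool
eqF a b = ⌊ a ≟ b ⌋

-- Group-theoretic hypotheses.  V = Fin n; S = { s i : i : Fin k }.

module _ {c ℓ : Level} (G : Group c ℓ) where
  open Group G renaming (Carrier to ∣G∣)

  IsFiniteGroup : Set (c Level.⊔ ℓ)
  IsFiniteGroup = ∃[ m ] Σ (Fin m → ∣G∣) (λ f → ∀ g → ∃[ i ] f i ≈ g)

  IsAction : ∀ {n} → (∣G∣ → Fin n → Fin n) → Set (c Level.⊔ ℓ)
  IsAction act =
      (∀ {g h} v → g ≈ h → act g v ≡ act h v)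
    × (∀ v → act ε v ≡ v)
    × (∀ g h v → act (g ∙ h) v ≡ act g (act h v))

  IsTransitive : ∀ {n} → (∣G∣ → Fin n → Fin n) → Set c
  IsTransitive act = ∀ v w → ∃[ g ] act g v ≡ w

  wordProd : ∀ {k} → (Fin k → ∣G∣) → List (Fin k) → ∣G∣
  wordProd s = foldr (λ i acc → s i ∙ acc) ε

  IsSubsetIndexing : ∀ {k} → (Fin k → ∣G∣) → Set ℓ
  IsSubsetIndexing s = ∀ i j → s i ≈ s j → i ≡ j

  -- S generates G (words in S suffice since S = S⁻¹)
  Generates : ∀ {k} → (Fin k → ∣G∣) → Set (c Level.⊔ ℓ)
  Generates s = ∀ g → ∃[ ws ] g ≈ wordProd s ws

  ContainsIdentity : ∀ {k} → (Fin k → ∣G∣) → Set ℓ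
  ContainsIdentity s = ∃[ i ] s i ≈ ε

  InverseClosed : ∀ {k} → (Fin k → ∣G∣) → Set ℓ
  InverseClosed s = ∀ i → ∃[ j ] s j ≈ s i ⁻¹

-- Everything below depends only on σ i = (action of the i-th element of S).

-- A relation on pairs of vertices: R a b a' b' means (a,b) ~ (a',b').
Rel4 : ℕ → Set
Rel4 n = Fin n → Fin n → Fin n → Fin n → Bool

module _ {n k : ℕ} (σ : Fin k → Fin n → Fin n) where

  -- colour of the configuration X_S: c(a,b) = { i : σ i a = b } ⊆ S
  colour : Fin n → Fin n → Fin k → Bool
  colour a b i = eqF (σ i a) b

  -- partition of V² into colour classes of c = c⁽⁰⁾
  wl0 : Rel4 n
  wl0 a b a' b' = allF (λ i → eqB (colour a b i) (colour a' b' i))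

  -- One WL step, expressed on the partition: (a,b),(a',b') get the same
  -- c⁽ʰ⁺¹⁾-colour iff same c⁽ʰ⁾-colour and, for every pair of c⁽ʰ⁾-colours
  -- (c₁,c₂) (each represented by a pair (x,y), resp. (z,t), of that colour;
  -- colours not attained give count 0 on both sides), the numbers
  -- |{w : c⁽ʰ⁾(a,w)=c₁, c⁽ʰ⁾(w,b)=c₂}| agree.
  wlStep : Rel4 n → Rel4 n
  wlStep R a b a' b' =
    R a b a' b' ∧
    allF (λ x → allF (λ y → allF (λ z → allF (λ t →
      countF (λ w → R a w x y ∧ R w b z t)
        ≡ᵇ countF (λ w → R a' w x y ∧ R w b' z t)))))

  wl : ℕ → Rel4 n
  wl zero    = wl0
  wl (suc h) = wlStep (wl h)

  Stable : ℕ → Set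
  Stable h = ∀ a b a' b' → wl (suc h) a b a' b' ≡ wl h a b a' b'

  IsWLNumber : ℕ → Set
  IsWLNumber h = Stable h × (∀ h' → h' < h → ¬ Stable h')

  walk : List (Fin k) → Fin n → Fin n
  walk []       v = v
  walk (i ∷ ws) v = walk ws (σ i v)

  PathOfLength : Fin n → Fin n → ℕ → Set
  PathOfLength v w ℓ = ∃[ ws ] (length ws ≡ ℓ × walk ws v ≡ w)

  IsDiameter : ℕ → Set
  IsDiameter d =
      (∀ v w → ∃[ ℓ ] (ℓ ≤ d × PathOfLength v w ℓ))
    × (∃[ v ] ∃[ w ] (∀ ℓ → PathOfLength v w ℓ → d ≤ ℓ))

-- Write ≡ₕ for equality of colours after h rounds.  By induction on h, pairs
-- (a, b) ≡ₕ (a', b') admit the same words of length ≤ 2^h leading from the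
-- first vertex to the second: a longer word splits into two halves, and the
-- equality of intersection numbers supplies a midpoint for the other pair.
-- Let d be the diameter and fix shortest paths p(v, w).  Once 3d + 1 ≤ 2^h,
-- two words A and B of lengths ≤ d and ≤ d + 1 that lead a to the same vertex
-- also lead a' to the same vertex, since A B⁻¹ p(a, b) leads a to b and is
-- short enough.  Hence x ↦ p(a, x) · a' is a bijection commuting with every
-- generator and sending (a, b) to (a', b').
-- Colours are invariant under such automorphisms of the Schreier graph, so
-- (a, b) ≡ₕ₊₁ (a', b') and the refinement is stable at h = ⌊log₂ d⌋ + 3.
module Submission where

open import Defs
open import Level using (Level)
open import Data.Nat using (ℕ; zero; suc; _+_; _*_; _^_; _≤_; _<_; _≡ᵇ_; z≤n; s≤s)
open import Data.Nat.Properties hiding (_≟_)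
open import Data.Nat.Logarithm using (⌊log₂_⌋; ⌊log₂[2^n]⌋≡n; ⌊log₂⌋-mono-≤)
open import Data.Nat.Tactic.RingSolver using (solve-∀)
open import Data.Bool using (Bool; true; false; _∧_; if_then_else_; T)
open import Data.Bool.Properties using (T-∧) renaming (_≟_ to _≟ᵇ_)
open import Data.Fin using (Fin; zero; suc; _≟_)
open import Data.Fin.Properties using (all?)
open import Data.Fin.Permutation using (Permutation′; permutation; _⟨$⟩ʳ_)
open import Data.List using (List; []; _∷_; [_]; length; _++_; take; drop; map; reverse; _∷ʳ_)
open import Data.List.Properties
  using (length-++; length-take; length-drop; take++drop≡id; length-map; length-reverse; unfold-reverse)
open import Data.Product using (∃-syntax; ∃₂; _×_; _,_; proj₁; proj₂)
open import Data.Unit using (tt)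
open import Data.Empty using (⊥-elim)
open import Function using (_∘_)
open import Function.Bundles using (Equivalence; Injection)
open import Function.Definitions using (Injective)
open import Function.Properties.Inverse using (↔⇒↣)
open import Relation.Nullary using (¬_; yes; no)
open import Relation.Nullary.Decidable using (toWitness; fromWitness)
open import Relation.Unary using (Decidable)
open import Relation.Binary.PropositionalEquality using (_≡_; refl; sym; trans; cong; cong₂; subst; subst₂; module ≡-Reasoning)
open import Algebra.Bundles using (Group)
import Algebra.Properties.CommutativeMonoid.Sum as Sum

private
  variable
    n k : ℕ

allF⁻ : {f : Fin n → Bool} → T (allF f) → ∀ i → T (f i)
allF⁻ {suc n} e zero    = proj₁ (Equivalence.to T-∧ e)
allF⁻ {suc n} e (suc i) = allF⁻ (proj₂ (Equivalence.to T-∧ e)) i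

allF⁺ : {f : Fin n → Bool} → (∀ i → T (f i)) → T (allF f)
allF⁺ {zero}  _ = tt
allF⁺ {suc n} p = Equivalence.from T-∧ (p zero , allF⁺ (p ∘ suc))

allF-cong : {f g : Fin n → Bool} → (∀ i → f i ≡ g i) → allF f ≡ allF g
allF-cong {zero}  _ = refl
allF-cong {suc n} p = cong₂ _∧_ (p zero) (allF-cong (p ∘ suc))

countF-cong : {f g : Fin n → Bool} → (∀ i → f i ≡ g i) → countF f ≡ countF g
countF-cong {zero}  _ = refl
countF-cong {suc n} p = cong₂ (λ b m → (if b then 1 else 0) + m) (p zero) (countF-cong (p ∘ suc))

countF-pos : {f : Fin n → Bool} (i : Fin n) → T (f i) → 0 < countF f
countF-pos {suc n} {f} zero    fi with f zero
... | true = s≤s z≤n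
countF-pos {suc n} {f} (suc i) fi =
  ≤-trans (countF-pos i fi) (m≤n+m _ (if f zero then 1 else 0))

countF-pos⇒∃ : {f : Fin n → Bool} → 0 < countF f → ∃[ i ] T (f i)
countF-pos⇒∃ {suc n} {f} pos with f zero in f0
... | true  = zero , subst T (sym f0) tt
... | false with countF-pos⇒∃ pos
...   | i , fi = suc i , fi

countF≡sum : (f : Fin n → Bool) → countF f ≡ Sum.sum +-0-commutativeMonoid (λ i → if f i then 1 else 0)
countF≡sum {zero}  f = refl
countF≡sum {suc n} f = cong ((if f zero then 1 else 0) +_) (countF≡sum (f ∘ suc))

countF-permute : (π : Permutation′ n) (f : Fin n → Bool) → countF (f ∘ (π ⟨$⟩ʳ_)) ≡ countF f
countF-permute {n} π f = begin
  countF (f ∘ (π ⟨$⟩ʳ_))                                      ≡⟨ countF≡sum (f ∘ (π ⟨$⟩ʳ_)) ⟩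
  Sum.sum +-0-commutativeMonoid (indicator ∘ (π ⟨$⟩ʳ_))      ≡⟨ Sum.sum-permute +-0-commutativeMonoid indicator π ⟨
  Sum.sum +-0-commutativeMonoid indicator                    ≡⟨ countF≡sum f ⟨
  countF f                                                   ∎
  where
  open ≡-Reasoning
  indicator : Fin n → ℕ
  indicator i = if f i then 1 else 0

T-eqB : ∀ {x y} → T (eqB x y) → x ≡ y
T-eqB {true}  {true}  _ = refl
T-eqB {false} {false} _ = refl

eqB-refl : ∀ x → T (eqB x x)
eqB-refl true  = tt
eqB-refl false = tt

eqB-sym : ∀ {x y} → T (eqB x y) → T (eqB y x)
eqB-sym {x} {y} e = subst (λ z → T (eqB z x)) (T-eqB {x} {y} e) (eqB-refl x)

eqF-injective : {f : Fin n → Fin n} → Injective _≡_ _≡_ f → ∀ a b → eqF (f a) (f b) ≡ eqF a b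
eqF-injective {f = f} f-inj a b with a ≟ b | f a ≟ f b
... | yes _   | yes _     = refl
... | no _    | no _      = refl
... | yes a≡b | no fa≢fb  = ⊥-elim (fa≢fb (cong f a≡b))
... | no a≢b  | yes fa≡fb = ⊥-elim (a≢b (f-inj fa≡fb))

∧-absorbˡ : ∀ {x y} → (T x → T y) → x ∧ y ≡ x
∧-absorbˡ {true}  {true}  _   = refl
∧-absorbˡ {true}  {false} x⇒y = ⊥-elim (x⇒y tt)
∧-absorbˡ {false}         _   = refl

least-satisfying : ∀ {p} {P : ℕ → Set p} → Decidable P → ∀ {m} → P m →
                   ∃[ h ] ((P h × (∀ h' → h' < h → ¬ P h')) × h ≤ m)
least-satisfying P? {zero} p = 0 , (p , λ _ ()) , z≤n
least-satisfying P? {suc m} p with P? 0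
... | yes p₀ = 0 , (p₀ , λ _ ()) , z≤n
... | no ¬p₀ with least-satisfying (P? ∘ suc) p
...   | h , (ph , below) , h≤m = suc h , (ph , below′) , s≤s h≤m
  where
  below′ : ∀ h' → h' < suc h → ¬ _
  below′ zero     _        = ¬p₀
  below′ (suc h') (s≤s h'<h) = below h' h'<h

n<2^[1+⌊log₂n⌋] : ∀ n → n < 2 ^ suc ⌊log₂ n ⌋
n<2^[1+⌊log₂n⌋] n = ≰⇒> λ 2^[1+L]≤n →
  1+n≰n (subst (_≤ ⌊log₂ n ⌋) (⌊log₂[2^n]⌋≡n (suc ⌊log₂ n ⌋)) (⌊log₂⌋-mono-≤ 2^[1+L]≤n))

3d+1≤2^[⌊log₂d⌋+3] : ∀ d → d + (suc d + d) ≤ 2 ^ (⌊log₂ d ⌋ + 3)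
3d+1≤2^[⌊log₂d⌋+3] d = begin
  d + (suc d + d)              ≤⟨ m≤m+n (d + (suc d + d)) (d + 3) ⟩
  d + (suc d + d) + (d + 3)    ≡⟨ four-times d ⟨
  4 * suc d                    ≤⟨ *-monoʳ-≤ 4 (n<2^[1+⌊log₂n⌋] d) ⟩
  4 * (2 * 2 ^ ⌊log₂ d ⌋)      ≡⟨ eight-times (2 ^ ⌊log₂ d ⌋) ⟩
  2 ^ ⌊log₂ d ⌋ * 2 ^ 3        ≡⟨ ^-distribˡ-+-* 2 ⌊log₂ d ⌋ 3 ⟨
  2 ^ (⌊log₂ d ⌋ + 3)          ∎
  where
  open ≤-Reasoning
  four-times : ∀ d → 4 * suc d ≡ d + (suc d + d) + (d + 3)
  four-times = solve-∀
  eight-times : ∀ x → 4 * (2 * x) ≡ x * 2 ^ 3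
  eight-times = solve-∀

split-≤ : ∀ {a} {A : Set a} m (ws : List A) → length ws ≤ 2 * m →
          ∃₂ λ u v → ws ≡ u ++ v × length u ≤ m × length v ≤ m
split-≤ m ws |ws|≤2m = take m ws , drop m ws , sym (take++drop≡id m ws) , |take|≤m , |drop|≤m
  where
  |take|≤m : length (take m ws) ≤ m
  |take|≤m = subst (_≤ m) (sym (length-take m ws)) (m⊓n≤m m (length ws))
  |drop|≤m : length (drop m ws) ≤ m
  |drop|≤m = subst (_≤ m) (sym (length-drop m ws))
    (m≤n+o⇒m∸n≤o (length ws) m (subst (length ws ≤_) (cong (m +_) (+-identityʳ m)) |ws|≤2m))

intersectionNumber : Rel4 n → (a b x y z t : Fin n) → ℕ
intersectionNumber R a b x y z t = countF (λ w → R a w x y ∧ R w b z t)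

SameIntersectionNumbers : Rel4 n → (a b a' b' : Fin n) → Set
SameIntersectionNumbers R a b a' b' =
  ∀ x y z t → intersectionNumber R a b x y z t ≡ intersectionNumber R a' b' x y z t

module SchreierGraph (σ : Fin k → Fin n → Fin n) where

  walk-++ : ∀ xs ys v → walk σ (xs ++ ys) v ≡ walk σ ys (walk σ xs v)
  walk-++ []       ys v = refl
  walk-++ (i ∷ xs) ys v = walk-++ xs ys (σ i v)

  WalksTransfer : ℕ → (a b a' b' : Fin n) → Set
  WalksTransfer L a b a' b' = ∀ ws → length ws ≤ L → walk σ ws a ≡ b → walk σ ws a' ≡ b'

  wlStep⁻ : ∀ R {a b a' b'} → T (wlStep σ R a b a' b') → T (R a b a' b') × SameIntersectionNumbers R a b a' b'
  wlStep⁻ R e with Equivalence.to T-∧ e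
  ... | r , same = r , λ x y z t → ≡ᵇ⇒≡ _ _ (allF⁻ (allF⁻ (allF⁻ (allF⁻ same x) y) z) t)

  wlStep⁺ : ∀ R {a b a' b'} → T (R a b a' b') → SameIntersectionNumbers R a b a' b' → T (wlStep σ R a b a' b')
  wlStep⁺ R r same = Equivalence.from T-∧
    (r , allF⁺ λ x → allF⁺ λ y → allF⁺ λ z → allF⁺ λ t → ≡⇒≡ᵇ _ _ (same x y z t))

  wl-refl : ∀ h a b → T (wl σ h a b a b)
  wl-refl zero    a b = allF⁺ λ i → eqB-refl (colour σ a b i)
  wl-refl (suc h) a b = wlStep⁺ (wl σ h) (wl-refl h a b) λ _ _ _ _ → refl

  wl-sym : ∀ h {a b a' b'} → T (wl σ h a b a' b') → T (wl σ h a' b' a b)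
  wl-sym zero {a} {b} {a'} {b'} e =
    allF⁺ λ i → eqB-sym {colour σ a b i} {colour σ a' b' i} (allF⁻ e i)
  wl-sym (suc h) e with wlStep⁻ (wl σ h) e
  ... | r , same = wlStep⁺ (wl σ h) (wl-sym h r) λ x y z t → sym (same x y z t)

  -- w itself is counted for (a, b), so equal intersection numbers provide such an m for (a', b').
  wl-midpoint : ∀ h {a b a' b'} → T (wl σ (suc h) a b a' b') →
                ∀ w → ∃[ m ] (T (wl σ h a w a' m) × T (wl σ h w b m b'))
  wl-midpoint h {a} {b} e w
    with countF-pos⇒∃ (subst (0 <_) (proj₂ (wlStep⁻ (wl σ h) e) a w w b)
                         (countF-pos w (Equivalence.from T-∧ (wl-refl h a w , wl-refl h w b))))
  ... | m , a'm∧mb' with Equivalence.to T-∧ a'm∧mb'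
  ...   | a'm , mb' = m , wl-sym h a'm , wl-sym h mb'

  module _ (π : Permutation′ n) (π-σ : ∀ i x → π ⟨$⟩ʳ σ i x ≡ σ i (π ⟨$⟩ʳ x)) where

    colour-invariant : ∀ x y i → colour σ (π ⟨$⟩ʳ x) (π ⟨$⟩ʳ y) i ≡ colour σ x y i
    colour-invariant x y i = begin
      eqF (σ i (π ⟨$⟩ʳ x)) (π ⟨$⟩ʳ y)   ≡⟨ cong (λ v → eqF v (π ⟨$⟩ʳ y)) (π-σ i x) ⟨
      eqF (π ⟨$⟩ʳ σ i x) (π ⟨$⟩ʳ y)     ≡⟨ eqF-injective (Injection.injective (↔⇒↣ π)) (σ i x) y ⟩
      eqF (σ i x) y                     ∎
      where open ≡-Reasoning

    wl-invariant : ∀ h x y x' y' → wl σ h (π ⟨$⟩ʳ x) (π ⟨$⟩ʳ y) x' y' ≡ wl σ h x y x' y'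
    wl-invariant zero    x y x' y' =
      allF-cong λ i → cong (λ c → eqB c (colour σ x' y' i)) (colour-invariant x y i)
    wl-invariant (suc h) x y x' y' =
      cong₂ _∧_ (wl-invariant h x y x' y')
        (allF-cong λ p → allF-cong λ q → allF-cong λ z → allF-cong λ t →
          cong (_≡ᵇ intersectionNumber (wl σ h) x' y' p q z t) (intersectionNumber-invariant p q z t))
      where
      open ≡-Reasoning
      R : Rel4 n
      R = wl σ h
      intersectionNumber-invariant : ∀ p q z t →
        intersectionNumber R (π ⟨$⟩ʳ x) (π ⟨$⟩ʳ y) p q z t ≡ intersectionNumber R x y p q z t
      intersectionNumber-invariant p q z t = begin
        countF (λ w → R (π ⟨$⟩ʳ x) w p q ∧ R w (π ⟨$⟩ʳ y) z t)
          ≡⟨ countF-permute π (λ w → R (π ⟨$⟩ʳ x) w p q ∧ R w (π ⟨$⟩ʳ y) z t) ⟨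
        countF (λ w → R (π ⟨$⟩ʳ x) (π ⟨$⟩ʳ w) p q ∧ R (π ⟨$⟩ʳ w) (π ⟨$⟩ʳ y) z t)
          ≡⟨ countF-cong (λ w → cong₂ _∧_ (wl-invariant h x w p q) (wl-invariant h w y z t)) ⟩
        countF (λ w → R x w p q ∧ R w y z t)
          ∎

  module IdentityGenerator (i₀ : Fin k) (σ-i₀ : ∀ v → σ i₀ v ≡ v) where

    colour-transfer : ∀ {a b a' b'} → T (wl σ 0 a b a' b') → ∀ i → σ i a ≡ b → σ i a' ≡ b'
    colour-transfer {a} {b} {a'} {b'} e i σia≡b =
      toWitness (subst T (T-eqB {colour σ a b i} {colour σ a' b' i} (allF⁻ e i)) (fromWitness σia≡b))

    wl⇒walksTransfer : ∀ h {a b a' b'} → T (wl σ h a b a' b') → WalksTransfer (2 ^ h) a b a' b'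
    wl⇒walksTransfer zero {a} {b} {a'} {b'} e [] _ a≡b =
      trans (sym (σ-i₀ a')) (colour-transfer e i₀ (trans (σ-i₀ a) a≡b))
    wl⇒walksTransfer zero e (i ∷ []) _ = colour-transfer e i
    wl⇒walksTransfer zero e (_ ∷ _ ∷ _) (s≤s ())
    wl⇒walksTransfer (suc h) {a} {b} {a'} {b'} e ws |ws|≤ walk-a≡b
      with split-≤ (2 ^ h) ws |ws|≤
    ... | u , v , refl , |u|≤ , |v|≤ with wl-midpoint h e (walk σ u a)
    ...   | m , aw≡a'm , wb≡mb' = begin
      walk σ (u ++ v) a'     ≡⟨ walk-++ u v a' ⟩
      walk σ v (walk σ u a') ≡⟨ cong (walk σ v) (wl⇒walksTransfer h aw≡a'm u |u|≤ refl) ⟩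
      walk σ v m             ≡⟨ wl⇒walksTransfer h wb≡mb' v |v|≤ (trans (sym (walk-++ u v a)) walk-a≡b) ⟩
      b'                     ∎
      where open ≡-Reasoning

  module InverseGenerators (σ⁻ : Fin k → Fin k) (σ⁻-σ : ∀ i v → σ (σ⁻ i) (σ i v) ≡ v) where

    inverseWord : List (Fin k) → List (Fin k)
    inverseWord ws = reverse (map σ⁻ ws)

    length-inverseWord : ∀ ws → length (inverseWord ws) ≡ length ws
    length-inverseWord ws = trans (length-reverse (map σ⁻ ws)) (length-map σ⁻ ws)

    walk-inverseWord : ∀ ws v → walk σ (inverseWord ws) (walk σ ws v) ≡ v
    walk-inverseWord []       v = refl
    walk-inverseWord (i ∷ ws) v = begin
      walk σ (reverse (map σ⁻ (i ∷ ws))) (walk σ ws (σ i v))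
        ≡⟨ cong (λ xs → walk σ xs (walk σ ws (σ i v))) (unfold-reverse (σ⁻ i) (map σ⁻ ws)) ⟩
      walk σ (inverseWord ws ∷ʳ σ⁻ i) (walk σ ws (σ i v))
        ≡⟨ walk-++ (inverseWord ws) [ σ⁻ i ] (walk σ ws (σ i v)) ⟩
      σ (σ⁻ i) (walk σ (inverseWord ws) (walk σ ws (σ i v)))
        ≡⟨ cong (σ (σ⁻ i)) (walk-inverseWord ws (σ i v)) ⟩
      σ (σ⁻ i) (σ i v)
        ≡⟨ σ⁻-σ i v ⟩
      v ∎
      where open ≡-Reasoning

    walk-injective : ∀ ws → Injective _≡_ _≡_ (walk σ ws)
    walk-injective ws {x} {y} walk-x≡walk-y = begin
      x                                   ≡⟨ walk-inverseWord ws x ⟨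
      walk σ (inverseWord ws) (walk σ ws x) ≡⟨ cong (walk σ (inverseWord ws)) walk-x≡walk-y ⟩
      walk σ (inverseWord ws) (walk σ ws y) ≡⟨ walk-inverseWord ws y ⟩
      y                                   ∎
      where open ≡-Reasoning

    -- A B⁻¹ r leads a to b, hence a' to b' = r · a', so B⁻¹ undoes A at a'.
    transfer-coincidence : ∀ {L a b a' b'} → WalksTransfer L a b a' b' →
      ∀ r → walk σ r a ≡ b → ∀ A B → length A + (length B + length r) ≤ L →
      walk σ A a ≡ walk σ B a → walk σ A a' ≡ walk σ B a'
    transfer-coincidence {L} {a} {b} {a'} {b'} transfer r r-a≡b A B |ABr|≤L A-a≡B-a =
      walk-injective B⁻ (begin
        walk σ B⁻ (walk σ A a') ≡⟨ walk-injective r (begin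
                                       walk σ r (walk σ B⁻ (walk σ A a')) ≡⟨ walk-ws a' ⟨
                                       walk σ ws a'                      ≡⟨ transfer ws |ws|≤L ws-a≡b ⟩
                                       b'                                ≡⟨ transfer r |r|≤L r-a≡b ⟨
                                       walk σ r a'                       ∎) ⟩
        a'                      ≡⟨ walk-inverseWord B a' ⟨
        walk σ B⁻ (walk σ B a') ∎)
      where
      open ≡-Reasoning
      B⁻ ws : List (Fin k)
      B⁻ = inverseWord B
      ws = A ++ (B⁻ ++ r)
      walk-ws : ∀ x → walk σ ws x ≡ walk σ r (walk σ B⁻ (walk σ A x))
      walk-ws x = trans (walk-++ A (B⁻ ++ r) x) (walk-++ B⁻ r (walk σ A x))
      ws-a≡b : walk σ ws a ≡ b
      ws-a≡b = begin
        walk σ ws a                        ≡⟨ walk-ws a ⟩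
        walk σ r (walk σ B⁻ (walk σ A a))  ≡⟨ cong (walk σ r ∘ walk σ B⁻) A-a≡B-a ⟩
        walk σ r (walk σ B⁻ (walk σ B a))  ≡⟨ cong (walk σ r) (walk-inverseWord B a) ⟩
        walk σ r a                         ≡⟨ r-a≡b ⟩
        b                                  ∎
      |ws|≤L : length ws ≤ L
      |ws|≤L = subst (_≤ L) (sym (trans (length-++ A)
        (cong (length A +_) (trans (length-++ B⁻) (cong (_+ length r) (length-inverseWord B)))))) |ABr|≤L
      |r|≤L : length r ≤ L
      |r|≤L = ≤-trans (m≤n+m (length r) (length B)) (≤-trans (m≤n+m _ (length A)) |ABr|≤L)

    module Transport {d : ℕ} (diameter : ∀ v w → ∃[ ℓ ] (ℓ ≤ d × PathOfLength σ v w ℓ)) where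

      path : Fin n → Fin n → List (Fin k)
      path v w = proj₁ (proj₂ (proj₂ (diameter v w)))

      length-path : ∀ v w → length (path v w) ≤ d
      length-path v w with diameter v w
      ... | _ , ℓ≤d , _ , |ws|≡ℓ , _ = subst (_≤ d) (sym |ws|≡ℓ) ℓ≤d

      walk-path : ∀ v w → walk σ (path v w) v ≡ w
      walk-path v w = proj₂ (proj₂ (proj₂ (proj₂ (diameter v w))))

      transport : Fin n → Fin n → Fin n → Fin n
      transport a a' x = walk σ (path a x) a'

      module _ {L a b a' b'} (3d+1≤L : d + (suc d + d) ≤ L) (transfer : WalksTransfer L a b a' b') where

        short-coincidence : ∀ A B → length A ≤ d → length B ≤ suc d →
                            walk σ A a ≡ walk σ B a → walk σ A a' ≡ walk σ B a'
        short-coincidence A B |A|≤d |B|≤1+d = transfer-coincidence transfer (path a b) (walk-path a b) A B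
          (≤-trans (+-mono-≤ |A|≤d (+-mono-≤ |B|≤1+d (length-path a b))) 3d+1≤L)

        transport-source : transport a a' a ≡ a'
        transport-source = short-coincidence (path a a) [] (length-path a a) z≤n (walk-path a a)

        transport-target : transport a a' b ≡ b'
        transport-target = transfer (path a b) (≤-trans (length-path a b) (≤-trans (m≤m+n d _) 3d+1≤L)) (walk-path a b)

        transport-σ : ∀ i x → transport a a' (σ i x) ≡ σ i (transport a a' x)
        transport-σ i x = begin
          walk σ (path a (σ i x)) a'  ≡⟨ short-coincidence (path a (σ i x)) (path a x ∷ʳ i)
                                           (length-path a (σ i x)) |path∷ʳi|≤1+d path-a-σix≡path∷ʳi ⟩
          walk σ (path a x ∷ʳ i) a'   ≡⟨ walk-++ (path a x) [ i ] a' ⟩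
          σ i (transport a a' x)      ∎
          where
          open ≡-Reasoning
          |path∷ʳi|≤1+d : length (path a x ∷ʳ i) ≤ suc d
          |path∷ʳi|≤1+d = subst (_≤ suc d) (sym (trans (length-++ (path a x)) (+-comm (length (path a x)) 1)))
            (s≤s (length-path a x))
          path-a-σix≡path∷ʳi : walk σ (path a (σ i x)) a ≡ walk σ (path a x ∷ʳ i) a
          path-a-σix≡path∷ʳi = trans (walk-path a (σ i x))
            (sym (trans (walk-++ (path a x) [ i ] a) (cong (σ i) (walk-path a x))))

        transport-inverse : ∀ x → transport a a' (transport a' a x) ≡ x
        transport-inverse x = trans
          (short-coincidence (path a (transport a' a x)) (path a' x) (length-path a _)
            (m≤n⇒m≤1+n (length-path a' x)) (walk-path a (transport a' a x)))
          (walk-path a' x)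

      transportPermutation : ∀ {L a b a' b'} → d + (suc d + d) ≤ L →
        WalksTransfer L a b a' b' → WalksTransfer L a' b' a b → Permutation′ n
      transportPermutation {a = a} {a' = a'} 3d+1≤L forward backward = permutation
        (transport a a') (transport a' a) (transport-inverse 3d+1≤L forward) (transport-inverse 3d+1≤L backward)

      module _ (i₀ : Fin k) (σ-i₀ : ∀ v → σ i₀ v ≡ v) (H : ℕ) (3d+1≤2^H : d + (suc d + d) ≤ 2 ^ H) where
        open IdentityGenerator i₀ σ-i₀

        wl-preserved : ∀ {a b a' b'} → T (wl σ H a b a' b') → T (wl σ (suc H) a b a' b')
        wl-preserved {a} {b} {a'} {b'} e =
          subst T (wl-invariant π (transport-σ 3d+1≤2^H forward) (suc H) a b a' b')
            (subst₂ (λ u v → T (wl σ (suc H) u v a' b'))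
              (sym (transport-source 3d+1≤2^H forward)) (sym (transport-target 3d+1≤2^H forward))
              (wl-refl (suc H) a' b'))
          where
          forward : WalksTransfer (2 ^ H) a b a' b'
          forward = wl⇒walksTransfer H e
          π : Permutation′ n
          π = transportPermutation 3d+1≤2^H forward (wl⇒walksTransfer H (wl-sym H e))

        wl-stable : Stable σ H
        wl-stable a b a' b' = ∧-absorbˡ (proj₂ ∘ Equivalence.to T-∧ ∘ wl-preserved)

Stable? : (σ : Fin k → Fin n → Fin n) → Decidable (Stable σ)
Stable? σ h = all? λ a → all? λ b → all? λ a' → all? λ b' → wl σ (suc h) a b a' b' ≟ᵇ wl σ h a b a' b'

module _ {c ℓ : Level} (G : Group c ℓ) {act : Group.Carrier G → Fin n → Fin n} (action : IsAction G act) where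
  open Group G using (_≈_; _∙_; ε; _⁻¹; ∙-congʳ; inverseˡ) renaming (trans to ≈-trans)

  act-identity : ∀ {g} → g ≈ ε → ∀ v → act g v ≡ v
  act-identity g≈ε v = trans (proj₁ action v g≈ε) (proj₁ (proj₂ action) v)

  act-inverse : ∀ {g h} → g ≈ h ⁻¹ → ∀ v → act g (act h v) ≡ v
  act-inverse {g} {h} g≈h⁻¹ v =
    trans (sym (proj₂ (proj₂ action) g h v)) (act-identity (≈-trans (∙-congʳ g≈h⁻¹) (inverseˡ h)) v)

theorem1 : ∀ {c ℓ : Level} (G : Group c ℓ) (n k : ℕ)
    (s : Fin k → Group.Carrier G)
    (act : Group.Carrier G → Fin n → Fin n) →
    IsFiniteGroup G →
    IsSubsetIndexing G s →
    Generates G s →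
    ContainsIdentity G s →
    InverseClosed G s →
    IsAction G act →
    IsTransitive G act →
    (d : ℕ) → IsDiameter (λ i → act (s i)) d →
    ∃[ h ] (IsWLNumber (λ i → act (s i)) h × h ≤ ⌊log₂ d ⌋ + 3)
-- Transitivity and generation are implied by the finite diameter.
theorem1 G n k s act _ _ _ (i₀ , s-i₀≈ε) inverse-closed action _ d (diameter , _) =
  least-satisfying (Stable? σ)
    (wl-stable i₀ (act-identity G action s-i₀≈ε) (⌊log₂ d ⌋ + 3) (3d+1≤2^[⌊log₂d⌋+3] d))
  where
  σ : Fin k → Fin n → Fin n
  σ i = act (s i)
  σ⁻ : Fin k → Fin k
  σ⁻ i = proj₁ (inverse-closed i)
  open SchreierGraph.InverseGenerators σ σ⁻ (λ i → act-inverse G action (proj₂ (inverse-closed i)))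
  open Transport diameter
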